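{- Let $X,Y$ be finite sets and $f:2^X\to 2^Y$ a poset embedding, and let $N=|f(X)|$. Then for every nonempty $I\subseteq X$, $$\Big|\bigcap_{a\in I} f(X\setminus\{a\})\Big|\le N-|I|.$$
   Context: A poset embedding $f:2^X\to 2^Y$ is an injective map satisfying $S\subseteq T\iff f(S)\subseteq f(T)$ for all $S,T\subseteq X$. -}

module Defs where

open import Data.Nat using (ℕ)
open import Data.Bool using (true; false)
open import Data.Fin using (Fin)
open import Data.Fin.Subset using (Subset; _⊆_; ⊤; _-_; ⋂)
open import Data.List using (List; map; filterᵇ)
open import Data.List.Base using (allFin)
open import Data.Vec using (lookup)
open import Data.Product using (_×_)
open import Function.Definitions using (Injective)
open import Function.Bundles using (_⇔_)
open import Relation.Binary.PropositionalEquality using (_≡_)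

IsPosetEmbedding : {m n : ℕ} → (Subset m → Subset n) → Set
IsPosetEmbedding {m} f =
  Injective _≡_ _≡_ f × (∀ (S T : Subset m) → (S ⊆ T) ⇔ (f S ⊆ f T))

elems : {m : ℕ} → Subset m → List (Fin m)
elems {m} I = filterᵇ (λ a → lookup I a) (allFin m)

-- ⋂_{a ∈ I} g a  (equal to ⊤ when I is empty)
⋂[_]_ : {m n : ℕ} → Subset m → (Fin m → Subset n) → Subset n
⋂[ I ] g = ⋂ (map g (elems I))

-- Remove the elements a₁, …, aₖ of I from X one at a time.  Since f reflects
-- inclusion and aᵢ₊₁ survives the first i removals, f(X ∖ {a₁,…,aᵢ}) is not
-- contained in f(X ∖ {aᵢ₊₁}); as f(X ∖ {a₁,…,aᵢ}) lies below
-- f X ∩ f(X ∖ {a₁}) ∩ … ∩ f(X ∖ {aᵢ}), each further intersection with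
-- f(X ∖ {aᵢ₊₁}) loses a point.  So the k-fold intersection has at most
-- |f X| − k elements.
module Submission where

open import Defs
open import Data.Nat using (ℕ; _≤_; _<_; _+_; suc; z≤n)
open import Data.Nat.Properties using (≤-reflexive; ≤-trans; module ≤-Reasoning; +-suc; +-identityʳ; +-monoˡ-≤; ≤-<-trans)
open import Data.Bool using (Bool; T?)
open import Data.Fin using (Fin; zero; suc)
open import Data.Fin.Properties using (¬∀⟶∃¬)
open import Data.Fin.Subset
  using (Subset; ⊤; _-_; ∣_∣; Nonempty; _⊆_; _⊈_; _⊂_; _∈_; _∉_; _∩_; ⋂; inside; outside)
open import Data.Fin.Subset.Properties
  using (_∈?_; ∈⊤; ⊆-max; x∈p∩q⁺; x∈p∩q⁻; p∩q⊆p; p∩q⊆q; x∈p∧x≢y⇒x∈p-y;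
         p⊆q⇒∣p∣≤∣q∣; p⊂q⇒∣p∣<∣q∣; x∈p⇒∣p-x∣<∣p∣)
open import Data.List using (List; []; _∷_; map; foldr; filterᵇ; length; tabulate)
open import Data.List.Relation.Unary.All using (All; []; _∷_)
open import Data.List.Relation.Unary.AllPairs using ([]; _∷_)
open import Data.List.Relation.Unary.Unique.Propositional using (Unique)
import Data.List.Relation.Unary.Unique.Propositional.Properties as Unique
open import Data.Vec using (_∷_; []; there; lookup)
open import Data.Product using (_×_; _,_; ∃; proj₁)
open import Function using (_∘_)
open import Function.Bundles using (Equivalence)
open import Relation.Binary.PropositionalEquality using (_≡_; _≢_; refl; sym; cong; subst)
open import Relation.Nullary using (contradiction)
open import Relation.Nullary.Decidable using (decidable-stable; _→-dec_)

private
  variable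
    n : ℕ
    p q r : Subset n

⊈⇒∃∈∉ : p ⊈ q → ∃ λ x → x ∈ p × x ∉ q
⊈⇒∃∈∉ {n} {p} {q} p⊈q with ¬∀⟶∃¬ n (λ x → x ∈ p → x ∈ q) (λ x → x ∈? p →-dec x ∈? q) (λ ⊆ → p⊈q (⊆ _))
... | x , x∈p↛x∈q =
  x , decidable-stable (x ∈? p) (λ x∉p → x∈p↛x∈q (λ x∈p → contradiction x∈p x∉p))
    , λ x∈q → x∈p↛x∈q (λ _ → x∈q)

p⊆q∧p⊈r⇒r∩q⊂q : p ⊆ q → p ⊈ r → r ∩ q ⊂ q
p⊆q∧p⊈r⇒r∩q⊂q p⊆q p⊈r with ⊈⇒∃∈∉ p⊈r
... | x , x∈p , x∉r = p∩q⊆q _ _ , x , p⊆q x∈p , x∉r ∘ proj₁ ∘ x∈p∩q⁻ _ _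

x∉p-x : ∀ (p : Subset n) x → x ∉ p - x
x∉p-x (_ ∷ p) zero    ()
x∉p-x (_ ∷ p) (suc x) (there x∈p-x) = x∉p-x p x x∈p-x

∈⋂-map-⊤- : ∀ {a : Fin n} L → All (a ≢_) L → a ∈ ⋂ (map (⊤ -_) L)
∈⋂-map-⊤- []      []          = ∈⊤
∈⋂-map-⊤- (b ∷ L) (a≢b ∷ a∉L) = x∈p∩q⁺ (x∈p∧x≢y⇒x∈p-y ∈⊤ a≢b , ∈⋂-map-⊤- L a∉L)

-- ∣ elems I ∣ = ∣ I ∣, generalised over the enumeration so that induction goes through.
length-filterᵇ-tabulate : ∀ {A : Set} (I : Subset n) (h : Fin n → A) (P : A → Bool) →
  (∀ i → P (h i) ≡ lookup I i) → length (filterᵇ P (tabulate h)) ≡ ∣ I ∣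
length-filterᵇ-tabulate []            h P P∘h≗I = refl
length-filterᵇ-tabulate (inside ∷ I)  h P P∘h≗I rewrite P∘h≗I zero =
  cong suc (length-filterᵇ-tabulate I (h ∘ suc) P (P∘h≗I ∘ suc))
length-filterᵇ-tabulate (outside ∷ I) h P P∘h≗I rewrite P∘h≗I zero =
  length-filterᵇ-tabulate I (h ∘ suc) P (P∘h≗I ∘ suc)

length-elems : ∀ (I : Subset n) → length (elems I) ≡ ∣ I ∣
length-elems I = length-filterᵇ-tabulate I (λ i → i) (lookup I) (λ _ → refl)

elems-unique : ∀ (I : Subset n) → Unique (elems I)
elems-unique {n} I = Unique.filter⁺ (T? ∘ lookup I) (Unique.allFin⁺ n)

module OrderEmbedding {m : ℕ} (f : Subset m → Subset n)
  (f-mono : ∀ {S T} → S ⊆ T → f S ⊆ f T) (f-reflects : ∀ {S T} → f S ⊆ f T → S ⊆ T) where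

  g : Fin m → Subset n
  g a = f (⊤ - a)

  ⋂-in-f⊤ : List (Fin m) → Subset n
  ⋂-in-f⊤ L = foldr _∩_ (f ⊤) (map g L)

  ∈f⊤∧∈⋂⇒∈⋂-in-f⊤ : ∀ L {x} → x ∈ f ⊤ → x ∈ ⋂ (map g L) → x ∈ ⋂-in-f⊤ L
  ∈f⊤∧∈⋂⇒∈⋂-in-f⊤ []      x∈f⊤ _   = x∈f⊤
  ∈f⊤∧∈⋂⇒∈⋂-in-f⊤ (a ∷ L) x∈f⊤ x∈⋂ with x∈p∩q⁻ _ _ x∈⋂
  ... | x∈ga , x∈⋂L = x∈p∩q⁺ (x∈ga , ∈f⊤∧∈⋂⇒∈⋂-in-f⊤ L x∈f⊤ x∈⋂L)

  ⋂⊆⋂-in-f⊤ : ∀ a L → ⋂ (map g (a ∷ L)) ⊆ ⋂-in-f⊤ (a ∷ L)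
  ⋂⊆⋂-in-f⊤ a L x∈⋂ = ∈f⊤∧∈⋂⇒∈⋂-in-f⊤ (a ∷ L) (f-mono (⊆-max _) (p∩q⊆p _ _ x∈⋂)) x∈⋂

  f-⋂⊆⋂-in-f⊤ : ∀ L → f (⋂ (map (⊤ -_) L)) ⊆ ⋂-in-f⊤ L
  f-⋂⊆⋂-in-f⊤ []      = λ x∈ → x∈
  f-⋂⊆⋂-in-f⊤ (a ∷ L) x∈ =
    x∈p∩q⁺ (f-mono (p∩q⊆p _ _) x∈ , f-⋂⊆⋂-in-f⊤ L (f-mono (p∩q⊆q _ _) x∈))

  f-⋂⊈g : ∀ {a} L → All (a ≢_) L → f (⋂ (map (⊤ -_) L)) ⊈ g a
  f-⋂⊈g {a} L a∉L ⊆ga = x∉p-x ⊤ a (f-reflects ⊆ga (∈⋂-map-⊤- L a∉L))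

  ⋂-in-f⊤-shrinks : ∀ {a} L → All (a ≢_) L → ∣ ⋂-in-f⊤ (a ∷ L) ∣ < ∣ ⋂-in-f⊤ L ∣
  ⋂-in-f⊤-shrinks L a∉L = p⊂q⇒∣p∣<∣q∣ (p⊆q∧p⊈r⇒r∩q⊂q (f-⋂⊆⋂-in-f⊤ L) (f-⋂⊈g L a∉L))

  ∣⋂-in-f⊤∣+length≤∣f⊤∣ : ∀ L → Unique L → ∣ ⋂-in-f⊤ L ∣ + length L ≤ ∣ f ⊤ ∣
  ∣⋂-in-f⊤∣+length≤∣f⊤∣ []      []          = ≤-reflexive (+-identityʳ _)
  ∣⋂-in-f⊤∣+length≤∣f⊤∣ (a ∷ L) (a∉L ∷ L!) = begin
    ∣ ⋂-in-f⊤ (a ∷ L) ∣ + suc (length L)  ≡⟨ +-suc _ _ ⟩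
    suc ∣ ⋂-in-f⊤ (a ∷ L) ∣ + length L    ≤⟨ +-monoˡ-≤ (length L) (⋂-in-f⊤-shrinks L a∉L) ⟩
    ∣ ⋂-in-f⊤ L ∣ + length L              ≤⟨ ∣⋂-in-f⊤∣+length≤∣f⊤∣ L L! ⟩
    ∣ f ⊤ ∣                               ∎
    where open ≤-Reasoning

  ∣⋂∣+length≤∣f⊤∣ : ∀ L → Unique L → 0 < length L → ∣ ⋂ (map g L) ∣ + length L ≤ ∣ f ⊤ ∣
  ∣⋂∣+length≤∣f⊤∣ (a ∷ L) L! _ =
    ≤-trans (+-monoˡ-≤ (suc (length L)) (p⊆q⇒∣p∣≤∣q∣ (⋂⊆⋂-in-f⊤ a L))) (∣⋂-in-f⊤∣+length≤∣f⊤∣ (a ∷ L) L!)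

lemma2 : (m n : ℕ) (f : Subset m → Subset n) → IsPosetEmbedding f →
    (I : Subset m) → Nonempty I →
    ∣ ⋂[ I ] (λ a → f (⊤ - a)) ∣ + ∣ I ∣ ≤ ∣ f ⊤ ∣
lemma2 m n f (_ , ⊆⇔f⊆) I (x , x∈I) =
  subst (λ k → ∣ ⋂[ I ] (λ a → f (⊤ - a)) ∣ + k ≤ ∣ f ⊤ ∣) (length-elems I)
    (∣⋂∣+length≤∣f⊤∣ (elems I) (elems-unique I) (subst (0 <_) (sym (length-elems I)) 0<∣I∣))
  where
  open OrderEmbedding f (Equivalence.to (⊆⇔f⊆ _ _)) (Equivalence.from (⊆⇔f⊆ _ _))
  0<∣I∣ : 0 < ∣ I ∣
  0<∣I∣ = ≤-<-trans z≤n (x∈p⇒∣p-x∣<∣p∣ x∈I)
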